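{- Let $S=\{x^2+c_1,\dots,x^2+c_s\}$ for some $c_i\in\mathbb{Z}$. If $|c_i^2+c_j|>\max_{1\le k\le s}|c_k|$ for all $1\le i,j\le s$, then $\mathrm{Orb}_S(0)$ does not contain a finite orbit point for $S$.
   Context: Let $M_S$ be the monoid generated by $S$ under composition (including the identity). For a point $P$, $\mathrm{Orb}_S(P)=\{f(P):f\in M_S\}$; $P$ is a finite orbit point for $S$ if $\mathrm{Orb}_S(P)$ is finite. -}

module Defs where

open import Data.Nat using (ℕ; zero; suc; _⊔_)
open import Data.Integer using (ℤ; _+_; _*_; ∣_∣)
open import Data.Fin using (Fin; zero; suc)
open import Data.List using (List; []; _∷_)
open import Data.List.Membership.Propositional using (_∈_)
open import Data.Product using (∃)
open import Relation.Binary.PropositionalEquality using (_≡_)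
open import Relation.Nullary using (¬_)

quadMap : ∀ {s} → (Fin s → ℤ) → Fin s → ℤ → ℤ
quadMap c i x = x * x + c i

-- An element of the monoid M_S generated by S (identity included) is a
-- finite composition of maps of S, represented by a word (list of indices):
-- evalWord c (i₁ ∷ i₂ ∷ … ∷ iₖ ∷ []) = f_{i₁} ∘ f_{i₂} ∘ … ∘ f_{iₖ},
-- and the empty word is the identity.
evalWord : ∀ {s} → (Fin s → ℤ) → List (Fin s) → ℤ → ℤ
evalWord c []      x = x
evalWord c (i ∷ w) x = quadMap c i (evalWord c w x)

InOrb : ∀ {s} → (Fin s → ℤ) → ℤ → ℤ → Set
InOrb c P Q = ∃ λ (w : List (Fin _)) → Q ≡ evalWord c w P

FiniteOrbitPoint : ∀ {s} → (Fin s → ℤ) → ℤ → Set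
FiniteOrbitPoint c P = ∃ λ (L : List ℤ) → ∀ Q → InOrb c P Q → Q ∈ L

maxAbs : ∀ s → (Fin s → ℤ) → ℕ
maxAbs zero    c = 0
maxAbs (suc s) c = ∣ c zero ∣ ⊔ maxAbs s (λ k → c (suc k))

-- Write M = max |c_k|; the hypothesis with i = j rules out M = 0. If |x| > M ≥ 1
-- then |x|² ≥ 2|x| > |x| + M, so every map x ↦ x² + c_k strictly increases |x|
-- and preserves |x| > M. A point reached from 0 by two or more maps is an image
-- of some c_j² + c_i, which exceeds M in absolute value by hypothesis. So for
-- P ∈ Orb_S(0) the point f₁(f₁(P)) ∈ Orb_S(P) escapes, and its iterates under f₁
-- are points of Orb_S(P) of unbounded absolute value.
module Submission where

open import Defs
open import Data.Nat using (ℕ; _<_; _≤_)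
open import Data.Integer using (ℤ; _+_; _*_; ∣_∣; 0ℤ)
open import Data.Fin using (Fin)
open import Relation.Nullary using (¬_)

open import Data.Nat as ℕ using (suc; s≤s; z≤n)
import Data.Nat.Properties as ℕ
open import Data.Integer using (+_; +[1+_]; -[1+_]; _-_)
import Data.Integer.Properties as ℤ
open import Data.Fin using (zero)
open import Data.List using (List; []; _∷_; _++_; length; replicate)
open import Data.List.Properties using (length-replicate)
open import Data.List.Membership.Propositional using (_∈_)
open import Data.List.Relation.Unary.All using (lookup)
open import Algebra.Properties.AbelianGroup ℤ.+-0-abelianGroup using (//-rightDividesʳ)
open import Data.List.Extrema.Nat using (argmax; f[xs]≤f[argmax])
open import Data.Product using (_,_; ∃)
open import Relation.Binary.PropositionalEquality using (_≡_; refl; sym; cong; subst)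

n+m<n*n : ∀ {m n} → 0 < m → m < n → n ℕ.+ m < n ℕ.* n
n+m<n*n {m} {suc b} 0<m (s≤s m≤b) = ℕ.+-monoʳ-< (suc b) (begin-strict
  m             ≤⟨ m≤b ⟩
  b             <⟨ ℕ.n<1+n b ⟩
  suc b         ≤⟨ ℕ.m≤m*n (suc b) b ⦃ ℕ.>-nonZero (ℕ.<-≤-trans 0<m m≤b) ⦄ ⟩
  suc b ℕ.* b   ≡⟨ ℕ.*-comm (suc b) b ⟩
  b ℕ.* suc b   ∎)
  where open ℕ.≤-Reasoning

∣x∣<∣x*x+c∣ : ∀ {M} x c → 0 < M → M < ∣ x ∣ → ∣ c ∣ ≤ M → ∣ x ∣ < ∣ x * x + c ∣
∣x∣<∣x*x+c∣ {M} x c 0<M M<∣x∣ ∣c∣≤M = ℕ.+-cancelʳ-< M ∣ x ∣ ∣ x * x + c ∣ (begin-strict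
  ∣ x ∣ ℕ.+ M                <⟨ n+m<n*n 0<M M<∣x∣ ⟩
  ∣ x ∣ ℕ.* ∣ x ∣            ≡⟨ ℤ.∣i*j∣≡∣i∣*∣j∣ x x ⟨
  ∣ x * x ∣                  ≡⟨ cong ∣_∣ (//-rightDividesʳ c (x * x)) ⟨
  ∣ x * x + c - c ∣          ≤⟨ ℤ.∣i-j∣≤∣i∣+∣j∣ (x * x + c) c ⟩
  ∣ x * x + c ∣ ℕ.+ ∣ c ∣    ≤⟨ ℕ.+-monoʳ-≤ ∣ x * x + c ∣ ∣c∣≤M ⟩
  ∣ x * x + c ∣ ℕ.+ M        ∎)
  where open ℕ.≤-Reasoning

∣∣-bounded : (L : List ℤ) → ∃ λ B → ∀ {z} → z ∈ L → ∣ z ∣ ≤ B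
∣∣-bounded L = ∣ argmax ∣_∣ 0ℤ L ∣ , lookup (f[xs]≤f[argmax] 0ℤ L)

∣c∣≤maxAbs : ∀ s (c : Fin s → ℤ) k → ∣ c k ∣ ≤ maxAbs s c
∣c∣≤maxAbs (suc s) c zero    = ℕ.m≤m⊔n _ _
∣c∣≤maxAbs (suc s) c (Fin.suc k) =
  ℕ.≤-trans (∣c∣≤maxAbs s (λ k → c (Fin.suc k)) k) (ℕ.m≤n⊔m _ _)

evalWord-++ : ∀ {s} (c : Fin s → ℤ) u w x →
              evalWord c (u ++ w) x ≡ evalWord c u (evalWord c w x)
evalWord-++ c []      w x = refl
evalWord-++ c (i ∷ u) w x = cong (quadMap c i) (evalWord-++ c u w x)

FiniteOrbitPoint-closed : ∀ {s} (c : Fin s → ℤ) {P Q} →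
                          FiniteOrbitPoint c P → InOrb c P Q → FiniteOrbitPoint c Q
FiniteOrbitPoint-closed c {P} (L , orbit⊆L) (w , refl) =
  L , λ { R (u , refl) → orbit⊆L R (u ++ w , sym (evalWord-++ c u w P)) }

module _ {s} (c : Fin s → ℤ) where

  Escapes : ℤ → Set
  Escapes x = maxAbs s c < ∣ x ∣

  maxAbs-positive : (∀ i j → maxAbs s c < ∣ c i * c i + c j ∣) → Fin s → 0 < maxAbs s c
  maxAbs-positive hyp k with c k | hyp k k | ∣c∣≤maxAbs s c k
  ... | + 0      | ()  | _
  ... | +[1+ _ ] | _   | ∣ck∣≤M = ℕ.≤-trans (s≤s z≤n) ∣ck∣≤M
  ... | -[1+ _ ] | _   | ∣ck∣≤M = ℕ.≤-trans (s≤s z≤n) ∣ck∣≤M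

  quadMap-grows : 0 < maxAbs s c → ∀ i x → Escapes x → ∣ x ∣ < ∣ quadMap c i x ∣
  quadMap-grows 0<M i x x-escapes = ∣x∣<∣x*x+c∣ x (c i) 0<M x-escapes (∣c∣≤maxAbs s c i)

  evalWord-grows : 0 < maxAbs s c → ∀ {x} → Escapes x →
                   ∀ u → length u ℕ.+ ∣ x ∣ ≤ ∣ evalWord c u x ∣
  evalWord-grows 0<M x-escapes []          = ℕ.≤-refl
  evalWord-grows 0<M {x} x-escapes (i ∷ u) =
    ℕ.≤-trans (s≤s grown) (quadMap-grows 0<M i (evalWord c u x) (ℕ.<-≤-trans x-escapes ∣x∣≤∣ux∣))
    where
    grown : length u ℕ.+ ∣ x ∣ ≤ ∣ evalWord c u x ∣
    grown = evalWord-grows 0<M x-escapes u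
    ∣x∣≤∣ux∣ : ∣ x ∣ ≤ ∣ evalWord c u x ∣
    ∣x∣≤∣ux∣ = ℕ.≤-trans (ℕ.m≤n+m ∣ x ∣ (length u)) grown

  evalWord-escapes-from-0 : (∀ i j → maxAbs s c < ∣ c i * c i + c j ∣) → 0 < maxAbs s c →
                            ∀ i j u → Escapes (evalWord c (i ∷ j ∷ u) 0ℤ)
  evalWord-escapes-from-0 hyp 0<M i j []      =
    subst (λ t → Escapes (t * t + c i)) (sym (ℤ.+-identityˡ (c j))) (hyp j i)
  evalWord-escapes-from-0 hyp 0<M i j (k ∷ u) =
    ℕ.<-trans jku-escapes (quadMap-grows 0<M i (evalWord c (j ∷ k ∷ u) 0ℤ) jku-escapes)
    where
    jku-escapes : Escapes (evalWord c (j ∷ k ∷ u) 0ℤ)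
    jku-escapes = evalWord-escapes-from-0 hyp 0<M j k u

  escaping-not-FiniteOrbitPoint : 0 < maxAbs s c → Fin s → ∀ {x} → Escapes x →
                                  ¬ FiniteOrbitPoint c x
  escaping-not-FiniteOrbitPoint 0<M i {x} x-escapes (L , orbit⊆L) with ∣∣-bounded L
  ... | B , L-bounded = ℕ.<-irrefl refl (begin-strict
    B                       <⟨ ℕ.m≤m+n (suc B) ∣ x ∣ ⟩
    suc B ℕ.+ ∣ x ∣         ≡⟨ cong (ℕ._+ ∣ x ∣) (length-replicate (suc B)) ⟨
    length far ℕ.+ ∣ x ∣    ≤⟨ evalWord-grows 0<M x-escapes far ⟩
    ∣ evalWord c far x ∣    ≤⟨ L-bounded (orbit⊆L _ (far , refl)) ⟩
    B                       ∎)
    where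
    open ℕ.≤-Reasoning
    far : List (Fin s)
    far = replicate (suc B) i

lemma3p8 : (s : ℕ) → 1 ≤ s → (c : Fin s → ℤ) →
    (∀ (i j : Fin s) → maxAbs s c < ∣ c i * c i + c j ∣) →
    ∀ (P : ℤ) → InOrb c 0ℤ P → ¬ FiniteOrbitPoint c P
lemma3p8 (suc s) _ c hyp _ (w , refl) P-finite =
  escaping-not-FiniteOrbitPoint c 0<M zero (evalWord-escapes-from-0 c hyp 0<M zero zero w)
    (FiniteOrbitPoint-closed c P-finite (zero ∷ zero ∷ [] , refl))
  where
  0<M : 0 < maxAbs (suc s) c
  0<M = maxAbs-positive c hyp zero
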